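{- Let $q$ be an odd prime power, $\mathbb{F}=\mathbb{F}_q$, $S=S(\mathbb{F})$. Both mappings $(x,y)\mapsto(y,x)$ and $(x,y)\mapsto(x^{ -1},y^{ -1})$ permute $S$. Moreover, for all $i,j,r,s\in\{0,1\}$ and $(x,y)\in S$, \[ (x,y)\in S_{ij}^{rs}\iff (y,x)\in S_{ji}^{sr}\iff (x^{ -1},y^{ -1})\in S_{1-i,1-j}^{1-r,1-s}. \]
   Context: A square is an element $z^2$, $z\in\mathbb{F}$; a nonsquare is an element that is not a square. $\Sigma$ is the set of $(a,b)\in\mathbb{F}^2$ with $a\ne b$, $a,b\notin\{0,1\}$ and $ab$, $(1-a)(1-b)$ squares. $S$ is the set of $(x,y)\in\mathbb{F}^2$ with $x,y$ squares, $x\ne y$, $\{x,y\}\cap\{0,1\}=\emptyset$. $\Psi:\Sigma\to S$ is $\Psi(a,b)=(a/b,(1-a)/(1-b))$. For $(a,b)\in\Sigma$ let $\psi=\psi_{a,b}$, $\psi(u)=au$ if $u$ is a square and $\psi(u)=bu$ if $u$ is a nonsquare. Let $E(a,b)$ be the set of $(u,v)\in\mathbb{F}^2\setminus\{(0,0)\}$ with $\psi(\psi(u)-v)=\psi(-v)+\psi(u-v-\psi(-v))$. For $i,j,r,s\in\{0,1\}$, $E_{ij}^{rs}(a,b)$ is the set of $(u,v)\in E(a,b)$ such that: $i=0$ iff $u$ is a square; $j=0$ iff $-v$ is a square; $r=0$ iff $\psi(u)-v$ is a square; $s=0$ iff $u-v-\psi(-v)$ is a square. $\Sigma_{ij}^{rs}=\{(a,b)\in\Sigma:E_{ij}^{rs}(a,b)\ne\emptyset\}$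 and $S_{ij}^{rs}=\Psi(\Sigma_{ij}^{rs})$. -}

module Defs where

open import Level using (Level; _⊔_) renaming (suc to lsuc)
open import Algebra.Bundles using (CommutativeRing)
open import Data.Nat using (ℕ)
open import Data.Nat.DivMod using (_%_)
open import Data.Fin using (Fin)
open import Data.Fin.Properties using (any?)
open import Data.Bool using (Bool; true; false)
open import Data.Product using (Σ; ∃; ∃-syntax; _×_; _,_; proj₁; proj₂)
open import Relation.Nullary using (¬_; Dec; yes; no)
open import Relation.Binary.Core using (Rel)
open import Relation.Binary.Definitions using (Decidable)
open import Relation.Binary.PropositionalEquality using (_≡_)

-- A finite field of odd order q.  (Every finite field has prime-power order,
-- so "q an odd prime power, F = F_q" is exactly "a finite field with q
-- elements, q odd".)  The field is a commutative ring (with setoid equality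
-- _≈_, decidable), 0 ≠ 1, every nonzero element has an inverse, and it is
-- in bijection with Fin q.  x ⁻¹ is the inverse for x ≉ 0 (unspecified at 0).
record OddFiniteField (c ℓ : Level) : Set (lsuc (c ⊔ ℓ)) where
  field
    commRing : CommutativeRing c ℓ
  open CommutativeRing commRing public
  field
    _≟_            : Decidable _≈_
    0≉1            : ¬ (0# ≈ 1#)
    _⁻¹            : Carrier → Carrier
    ⁻¹-inverse     : ∀ x → ¬ (x ≈ 0#) → (x * (x ⁻¹)) ≈ 1#
    q              : ℕ
    enum           : Fin q → Carrier
    enum-injective : ∀ i j → enum i ≈ enum j → i ≡ j
    enum-surjective : ∀ x → ∃[ i ] (enum i ≈ x)
    q-odd          : q % 2 ≡ 1

module Notions {c ℓ : Level} (F : OddFiniteField c ℓ) where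
  open OddFiniteField F

  infixl 6 _−_
  _−_ : Carrier → Carrier → Carrier
  x − y = x + (- y)

  _/_ : Carrier → Carrier → Carrier
  x / y = x * (y ⁻¹)

  IsSquare : Carrier → Set (c ⊔ ℓ)
  IsSquare x = ∃[ z ] ((z * z) ≈ x)

  isSquare? : ∀ x → Dec (IsSquare x)
  isSquare? x with any? (λ k → (enum k * enum k) ≟ x)
  ... | yes (k , e) = yes (enum k , e)
  ... | no ¬e = no λ { (z , e) → ¬e (proj₁ (enum-surjective z)
        , trans (*-cong (proj₂ (enum-surjective z)) (proj₂ (enum-surjective z))) e) }

  -- index bit: Bit false x ⇔ x is a square ("index 0"), Bit true x ⇔ nonsquare ("index 1")
  Bit : Bool → Carrier → Set (c ⊔ ℓ)
  Bit false x = IsSquare x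
  Bit true  x = ¬ IsSquare x

  InΣ : Carrier → Carrier → Set (c ⊔ ℓ)
  InΣ a b = ¬ (a ≈ b) × ¬ (a ≈ 0#) × ¬ (a ≈ 1#) × ¬ (b ≈ 0#) × ¬ (b ≈ 1#)
            × IsSquare (a * b) × IsSquare ((1# − a) * (1# − b))

  InS : Carrier → Carrier → Set (c ⊔ ℓ)
  InS x y = IsSquare x × IsSquare y × ¬ (x ≈ y)
            × ¬ (x ≈ 0#) × ¬ (x ≈ 1#) × ¬ (y ≈ 0#) × ¬ (y ≈ 1#)

  ψ : Carrier → Carrier → Carrier → Carrier
  ψ a b u with isSquare? u
  ... | yes _ = a * u
  ... | no  _ = b * u

  InE : Carrier → Carrier → Carrier → Carrier → Set ℓ
  InE a b u v = ¬ ((u ≈ 0#) × (v ≈ 0#))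
              × (ψ a b (ψ a b u − v) ≈ (ψ a b (- v) + ψ a b (u − v − ψ a b (- v))))

  InEijrs : (i j r s : Bool) → Carrier → Carrier → Carrier → Carrier → Set (c ⊔ ℓ)
  InEijrs i j r s a b u v = InE a b u v × Bit i u × Bit j (- v)
                           × Bit r (ψ a b u − v) × Bit s (u − v − ψ a b (- v))

  InΣijrs : (i j r s : Bool) → Carrier → Carrier → Set (c ⊔ ℓ)
  InΣijrs i j r s a b = InΣ a b × ∃[ u ] ∃[ v ] InEijrs i j r s a b u v

  InSijrs : (i j r s : Bool) → Carrier → Carrier → Set (c ⊔ ℓ)
  InSijrs i j r s x y = ∃[ a ] ∃[ b ] (InΣijrs i j r s a b
                          × (x ≈ (a / b)) × (y ≈ ((1# − a) / (1# − b))))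

  Permutes : (Carrier × Carrier → Carrier × Carrier) → Set (c ⊔ ℓ)
  Permutes f =
      (∀ x y → InS x y → InS (proj₁ (f (x , y))) (proj₂ (f (x , y))))
    × (∀ x y x′ y′ → InS x y → InS x′ y′
         → proj₁ (f (x , y)) ≈ proj₁ (f (x′ , y′))
         → proj₂ (f (x , y)) ≈ proj₂ (f (x′ , y′))
         → (x ≈ x′) × (y ≈ y′))
    × (∀ x y → InS x y → ∃[ x′ ] ∃[ y′ ] (InS x′ y′
         × (proj₁ (f (x′ , y′)) ≈ x) × (proj₂ (f (x′ , y′)) ≈ y)))

-- Both symmetries of S lift to Σ and to the solution sets E(a,b).  The swap is realised by
-- (a,b) ↦ (1−a,1−b) together with (u,v) ↦ (−v,−u): since ψ_{1−a,1−b}(z) = z − ψ_{a,b}(z), this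
-- preserves the equation defining E and exchanges u with −v and ψ(u) − v with u − v − ψ(−v).
-- Inversion is realised by (a,b) ↦ (b,a) together with (u,v) ↦ (κu,κv) for a nonsquare κ:
-- as a product of two nonsquares is a square, ψ_{b,a}(κz) = κψ_{a,b}(z), and multiplying by κ
-- flips the square class of each of u, −v, ψ(u) − v, u − v − ψ(−v), provided these are nonzero.
-- That is the only delicate point: if ψ(u) = v then, writing α, β, γ for the multipliers of ψ
-- at u, −v and u − v − ψ(−v), one gets γ(1 − α + αβ) = αβ, which is incompatible with the
-- square-class constraints defining Σ; the swap turns this into the last nonvanishing claim.
-- That nonsquares exist and multiply to squares is a count: as q is odd, z ↦ z² is two-to-one
-- on the nonzero elements.

module Submission where

open import Defs

open import Level using (Level)
open import Algebra.Bundles using (CommutativeRing; RawRing)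
open import Data.Nat as ℕ using (ℕ; zero; suc)
import Data.Nat.Properties as ℕ
open import Data.Product using (∃; _,_; proj₁; proj₂)
import Data.Product as Product
import Data.Product.Properties as Product
open import Data.Maybe using (Maybe; just; nothing)
open import Relation.Nullary using (¬_; yes; no)
open import Relation.Binary.PropositionalEquality as ≡ using (_≡_)

-- Algebra.Solver.Ring must decide equality of coefficients by computation, which the abstract
-- field's _≟_ cannot do; so coefficients are integers, evaluated in the ring.
module IntegerCoefficientSolver {c ℓ : Level} (R : CommutativeRing c ℓ) where
  open CommutativeRing R hiding (zero)
  open import Algebra.Properties.Semiring.Mult.TCOptimised semiring
    using (_×_; 1+×; ×-homo-+; ×1-homo-*)
  open import Algebra.Properties.Ring ring using (x[y-z]≈xy-xz; [y-z]x≈yx-zx)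
  open import Algebra.Properties.AbelianGroup +-abelianGroup
    using (⁻¹-∙-comm; ⁻¹-anti-homo‿-)
  open import Algebra.Properties.Group +-group using (ε⁻¹≈ε)
  open import Algebra.Properties.CommutativeSemigroup +-commutativeSemigroup
    using (interchange)
  open import Algebra.Solver.Ring.AlmostCommutativeRing
    using (_-Raw-AlmostCommutative⟶_; fromCommutativeRing)
  open import Relation.Binary.Reasoning.Setoid setoid

  -- An integer is a pair (m , n) standing for m − n; normalisation makes one side zero,
  -- so that propositional equality of normal pairs decides equality of coefficients.
  Difference : Set
  Difference = ℕ Product.× ℕ

  normalise : Difference → Difference
  normalise (suc m , suc n) = normalise (m , n)
  normalise p               = p

  -- Evaluated so that the coefficients 0 and 1 become 0# and 1# definitionally.
  ⟦_⟧ : Difference → Carrier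
  ⟦ m     , zero  ⟧ = m × 1#
  ⟦ zero  , suc n ⟧ = - (suc n × 1#)
  ⟦ suc m , suc n ⟧ = ⟦ m , n ⟧

  [x+y]-[x+z]≈y-z : ∀ x y z → (x + y) - (x + z) ≈ y - z
  [x+y]-[x+z]≈y-z x y z = begin
    (x + y) - (x + z)     ≈⟨ +-congˡ (⁻¹-∙-comm x z) ⟨
    (x + y) + (- x - z)   ≈⟨ interchange x y (- x) (- z) ⟩
    (x - x) + (y - z)     ≈⟨ +-congʳ (-‿inverseʳ x) ⟩
    0# + (y - z)          ≈⟨ +-identityˡ _ ⟩
    y - z                 ∎

  suc-cancel : ∀ m n → suc m × 1# - suc n × 1# ≈ m × 1# - n × 1#
  suc-cancel m n =
    trans (+-cong (1+× m 1#) (-‿cong (1+× n 1#))) ([x+y]-[x+z]≈y-z 1# (m × 1#) (n × 1#))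

  ⟦⟧-difference : ∀ m n → ⟦ m , n ⟧ ≈ m × 1# - n × 1#
  ⟦⟧-difference m zero = begin
    m × 1#              ≈⟨ +-identityʳ _ ⟨
    m × 1# + 0#         ≈⟨ +-congˡ ε⁻¹≈ε ⟨
    m × 1# - 0#         ∎
  ⟦⟧-difference zero (suc n) = sym (+-identityˡ _)
  ⟦⟧-difference (suc m) (suc n) = trans (⟦⟧-difference m n) (sym (suc-cancel m n))

  ⟦normalise⟧ : ∀ m n → ⟦ normalise (m , n) ⟧ ≈ m × 1# - n × 1#
  ⟦normalise⟧ (suc m) (suc n) = trans (⟦normalise⟧ m n) (sym (suc-cancel m n))
  ⟦normalise⟧ zero    n       = ⟦⟧-difference zero n
  ⟦normalise⟧ (suc m) zero    = ⟦⟧-difference (suc m) zero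

  _⊕_ _⊗_ : Difference → Difference → Difference
  (m , n) ⊕ (m′ , n′) = normalise (m ℕ.+ m′ , n ℕ.+ n′)
  (m , n) ⊗ (m′ , n′) = normalise (m ℕ.* m′ ℕ.+ n ℕ.* n′ , m ℕ.* n′ ℕ.+ n ℕ.* m′)

  ⊖_ : Difference → Difference
  ⊖ (m , n) = (n , m)

  differences : RawRing Level.zero Level.zero
  differences = record
    { Carrier = Difference ; _≈_ = _≡_ ; _+_ = _⊕_ ; _*_ = _⊗_ ; -_ = ⊖_
    ; 0# = (0 , 0) ; 1# = (1 , 0) }

  [x-y]+[z-w]≈[x+z]-[y+w] : ∀ x y z w → (x - y) + (z - w) ≈ (x + z) - (y + w)
  [x-y]+[z-w]≈[x+z]-[y+w] x y z w = begin
    (x - y) + (z - w)     ≈⟨ interchange x (- y) z (- w) ⟩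
    (x + z) + (- y - w)   ≈⟨ +-congˡ (⁻¹-∙-comm y w) ⟩
    (x + z) - (y + w)     ∎

  ⊕-homo : ∀ p q → ⟦ p ⊕ q ⟧ ≈ ⟦ p ⟧ + ⟦ q ⟧
  ⊕-homo (m , n) (m′ , n′) = begin
    ⟦ normalise (m ℕ.+ m′ , n ℕ.+ n′) ⟧   ≈⟨ ⟦normalise⟧ (m ℕ.+ m′) (n ℕ.+ n′) ⟩
    (m ℕ.+ m′) × 1# - (n ℕ.+ n′) × 1#    ≈⟨ +-cong (×-homo-+ 1# m m′) (-‿cong (×-homo-+ 1# n n′)) ⟩
    (M + M′) - (N + N′)                  ≈⟨ [x-y]+[z-w]≈[x+z]-[y+w] M N M′ N′ ⟨
    (M - N) + (M′ - N′)                  ≈⟨ +-cong (⟦⟧-difference m n) (⟦⟧-difference m′ n′) ⟨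
    ⟦ m , n ⟧ + ⟦ m′ , n′ ⟧              ∎
    where M = m × 1#; N = n × 1#; M′ = m′ × 1#; N′ = n′ × 1#

  ⊗-homo : ∀ p q → ⟦ p ⊗ q ⟧ ≈ ⟦ p ⟧ * ⟦ q ⟧
  ⊗-homo (m , n) (m′ , n′) = begin
    ⟦ normalise (m ℕ.* m′ ℕ.+ n ℕ.* n′ , m ℕ.* n′ ℕ.+ n ℕ.* m′) ⟧
      ≈⟨ ⟦normalise⟧ (m ℕ.* m′ ℕ.+ n ℕ.* n′) (m ℕ.* n′ ℕ.+ n ℕ.* m′) ⟩
    (m ℕ.* m′ ℕ.+ n ℕ.* n′) × 1# - (m ℕ.* n′ ℕ.+ n ℕ.* m′) × 1#
      ≈⟨ +-cong (embed m m′ n n′) (-‿cong (embed m n′ n m′)) ⟩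
    (M * M′ + N * N′) - (M * N′ + N * M′)
      ≈⟨ [x-y]+[z-w]≈[x+z]-[y+w] (M * M′) (M * N′) (N * N′) (N * M′) ⟨
    (M * M′ - M * N′) + (N * N′ - N * M′)
      ≈⟨ +-congˡ (⁻¹-anti-homo‿- (N * M′) (N * N′)) ⟨
    (M * M′ - M * N′) - (N * M′ - N * N′)
      ≈⟨ +-cong (x[y-z]≈xy-xz M M′ N′) (-‿cong (x[y-z]≈xy-xz N M′ N′)) ⟨
    M * (M′ - N′) - N * (M′ - N′)
      ≈⟨ [y-z]x≈yx-zx (M′ - N′) M N ⟨
    (M - N) * (M′ - N′)
      ≈⟨ *-cong (⟦⟧-difference m n) (⟦⟧-difference m′ n′) ⟨
    ⟦ m , n ⟧ * ⟦ m′ , n′ ⟧ ∎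
    where
    M = m × 1#; N = n × 1#; M′ = m′ × 1#; N′ = n′ × 1#
    embed : ∀ a b c d → (a ℕ.* b ℕ.+ c ℕ.* d) × 1# ≈ (a × 1#) * (b × 1#) + (c × 1#) * (d × 1#)
    embed a b c d = trans (×-homo-+ 1# (a ℕ.* b) (c ℕ.* d)) (+-cong (×1-homo-* a b) (×1-homo-* c d))

  ⊖-homo : ∀ p → ⟦ ⊖ p ⟧ ≈ - ⟦ p ⟧
  ⊖-homo (m , n) = begin
    ⟦ n , m ⟧           ≈⟨ ⟦⟧-difference n m ⟩
    n × 1# - m × 1#     ≈⟨ ⁻¹-anti-homo‿- (m × 1#) (n × 1#) ⟨
    - (m × 1# - n × 1#) ≈⟨ -‿cong (⟦⟧-difference m n) ⟨
    - ⟦ m , n ⟧         ∎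

  evaluation : differences -Raw-AlmostCommutative⟶ fromCommutativeRing R
  evaluation = record
    { ⟦_⟧ = ⟦_⟧ ; +-homo = ⊕-homo ; *-homo = ⊗-homo ; -‿homo = ⊖-homo
    ; 0-homo = refl ; 1-homo = refl }

  ⟦⟧-≡? : ∀ p q → Maybe (⟦ p ⟧ ≈ ⟦ q ⟧)
  ⟦⟧-≡? p q with Product.≡-dec ℕ._≟_ ℕ._≟_ p q
  ... | yes ≡.refl = just refl
  ... | no _       = nothing

  open import Algebra.Solver.Ring differences (fromCommutativeRing R) evaluation ⟦⟧-≡? public
    using (Polynomial; solve; _:=_; _:+_; _:-_; _:*_; :-_; con)

  :1 : ∀ {n} → Polynomial n
  :1 = con (1 , 0)

module Counting where
  open import Data.Nat using (_≤_; _<_; z≤n; s≤s)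
  open import Data.Fin using (Fin; zero; suc; _≟_)
  open import Data.Fin.Properties using (suc-injective)
  open import Data.Empty using (⊥-elim)
  open import Function using (_∘_)
  open import Relation.Unary using (Pred; Decidable)
  open import Relation.Unary.Properties using (U?; _∩?_; ∁?)
  open import Relation.Nullary using (¬?)
  open import Relation.Nullary.Decidable using (_×-dec_)
  open import Data.Product using (_×_)

  private variable
    p q : Level
    n m : ℕ

  count : {P : Pred (Fin n) p} → Decidable P → ℕ
  count {zero}  P? = 0
  count {suc n} P? with P? zero
  ... | yes _ = suc (count (P? ∘ suc))
  ... | no  _ = count (P? ∘ suc)

  count-cong : {P : Pred (Fin n) p} {Q : Pred (Fin n) q} (P? : Decidable P) (Q? : Decidable Q) →
               (∀ k → P k → Q k) → (∀ k → Q k → P k) → count P? ≡ count Q?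
  count-cong {zero}  P? Q? P⊆Q Q⊆P = ≡.refl
  count-cong {suc n} P? Q? P⊆Q Q⊆P with P? zero | Q? zero
  ... | yes _  | yes _  = ≡.cong suc (count-cong (P? ∘ suc) (Q? ∘ suc) (P⊆Q ∘ suc) (Q⊆P ∘ suc))
  ... | no  _  | no  _  = count-cong (P? ∘ suc) (Q? ∘ suc) (P⊆Q ∘ suc) (Q⊆P ∘ suc)
  ... | yes p₀ | no ¬q₀ = ⊥-elim (¬q₀ (P⊆Q zero p₀))
  ... | no ¬p₀ | yes q₀ = ⊥-elim (¬p₀ (Q⊆P zero q₀))

  _∖_ : {P : Pred (Fin n) p} → Decidable P → (j : Fin n) → Decidable (λ k → P k × ¬ k ≡ j)
  (P? ∖ j) k = P? k ×-dec ¬? (k ≟ j)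

  count-∖-suc : {P : Pred (Fin (suc n)) p} (P? : Decidable P) (j : Fin n) →
                count ((P? ∘ suc) ∖ j) ≡ count ((P? ∖ suc j) ∘ suc)
  count-∖-suc P? j = count-cong ((P? ∘ suc) ∖ j) ((P? ∖ suc j) ∘ suc)
    (λ k (pk , k≢j) → pk , k≢j ∘ suc-injective) (λ k (pk , k≢j) → pk , k≢j ∘ ≡.cong suc)

  count-remove : {P : Pred (Fin n) p} (P? : Decidable P) {j : Fin n} → P j →
                 count P? ≡ suc (count (P? ∖ j))
  count-remove {suc n} P? {zero} pj with P? zero
  ... | yes _  = ≡.cong suc (count-cong (P? ∘ suc) ((P? ∖ zero) ∘ suc)
                   (λ k pk → pk , λ ()) (λ k → proj₁))
  ... | no ¬p₀ = ⊥-elim (¬p₀ pj)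
  count-remove {suc n} P? {suc j} pj with P? zero
  ... | yes _ = ≡.cong suc (≡.trans (count-remove (P? ∘ suc) pj) (≡.cong suc (count-∖-suc P? j)))
  ... | no _  = ≡.trans (count-remove (P? ∘ suc) pj) (≡.cong suc (count-∖-suc P? j))

  count-injection : {P : Pred (Fin n) p} {Q : Pred (Fin m) q} (P? : Decidable P) (Q? : Decidable Q)
    (f : ∀ k → P k → Fin m) → (∀ k pk → Q (f k pk)) →
    (∀ k k′ pk pk′ → f k pk ≡ f k′ pk′ → k ≡ k′) → count P? ≤ count Q?
  count-injection {zero}  P? Q? f f-into f-inj = z≤n
  count-injection {suc n} P? Q? f f-into f-inj with P? zero
  ... | no _   = count-injection (P? ∘ suc) Q? (f ∘ suc) (f-into ∘ suc)
                   (λ k k′ pk pk′ e → suc-injective (f-inj (suc k) (suc k′) pk pk′ e))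
  ... | yes p₀ = ≡.subst (suc (count (P? ∘ suc)) ≤_) (≡.sym (count-remove Q? (f-into zero p₀)))
                   (s≤s (count-injection (P? ∘ suc) (Q? ∖ f zero p₀) (f ∘ suc)
                     (λ k pk → f-into (suc k) pk , λ e → 0≢suc (f-inj zero (suc k) p₀ pk (≡.sym e)))
                     (λ k k′ pk pk′ e → suc-injective (f-inj (suc k) (suc k′) pk pk′ e))))
    where
    0≢suc : ∀ {k : Fin n} → ¬ zero ≡ suc k
    0≢suc ()

  count-split : {P : Pred (Fin n) p} {Q : Pred (Fin n) q} (P? : Decidable P) (Q? : Decidable Q) →
                count P? ≡ count (P? ∩? Q?) ℕ.+ count (P? ∩? ∁? Q?)
  count-split {zero}  P? Q? = ≡.refl
  count-split {suc n} P? Q? with P? zero | Q? zero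
  ... | yes _ | yes _ = ≡.cong suc (count-split (P? ∘ suc) (Q? ∘ suc))
  ... | yes _ | no _  = ≡.trans (≡.cong suc (count-split (P? ∘ suc) (Q? ∘ suc)))
                          (≡.sym (ℕ.+-suc (count ((P? ∘ suc) ∩? (Q? ∘ suc))) _))
  ... | no _  | _     = count-split (P? ∘ suc) (Q? ∘ suc)

  count-witness : {P : Pred (Fin n) p} (P? : Decidable P) → 0 < count P? → ∃ P
  count-witness {suc n} P? pos with P? zero
  ... | yes p₀ = zero , p₀
  ... | no _   = let k , pk = count-witness (P? ∘ suc) pos in suc k , pk

  count-U : count (U? {A = Fin n}) ≡ n
  count-U {zero}  = ≡.refl
  count-U {suc n} = ≡.cong suc count-U

module FieldFacts {c ℓ : Level} (F : OddFiniteField c ℓ) where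
  open OddFiniteField F
  open Notions F
  open IntegerCoefficientSolver commRing
  open import Data.Sum using (_⊎_; inj₁; inj₂)
  open import Data.Bool using (true; false)
  open import Algebra.Properties.Ring ring using (-0#≈0#; -‿involutive)
  open import Relation.Binary.Reasoning.Setoid setoid

  x-y≈0⇒x≈y : ∀ {x y} → x − y ≈ 0# → x ≈ y
  x-y≈0⇒x≈y {x} {y} e = begin
    x            ≈⟨ solve 2 (λ x y → x := (x :- y) :+ y) refl x y ⟩
    (x − y) + y  ≈⟨ +-congʳ e ⟩
    0# + y       ≈⟨ +-identityˡ y ⟩
    y            ∎

  x≈y⇒x-y≈0 : ∀ {x y} → x ≈ y → x − y ≈ 0#
  x≈y⇒x-y≈0 {y = y} e = trans (+-congʳ e) (-‿inverseʳ y)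

  +-cancelˡ : ∀ {x y z} → x + y ≈ x + z → y ≈ z
  +-cancelˡ {x} {y} {z} e = begin
    y              ≈⟨ solve 2 (λ x y → y := (:- x) :+ (x :+ y)) refl x y ⟩
    - x + (x + y)  ≈⟨ +-congˡ e ⟩
    - x + (x + z)  ≈⟨ solve 2 (λ x z → (:- x) :+ (x :+ z) := z) refl x z ⟩
    z              ∎

  x+y≈0⇒y≈-x : ∀ {x y} → x + y ≈ 0# → y ≈ - x
  x+y≈0⇒y≈-x {x} e = +-cancelˡ (trans e (sym (-‿inverseʳ x)))

  -x≈0⇒x≈0 : ∀ {x} → - x ≈ 0# → x ≈ 0#
  -x≈0⇒x≈0 {x} e = trans (sym (-‿involutive x)) (trans (-‿cong e) -0#≈0#)

  1-x≉0 : ∀ {x} → ¬ x ≈ 1# → ¬ 1# − x ≈ 0#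
  1-x≉0 x≉1 e = x≉1 (sym (x-y≈0⇒x≈y e))

  1-[1-x]≈x : ∀ x → 1# − (1# − x) ≈ x
  1-[1-x]≈x = solve 1 (λ x → :1 :- (:1 :- x) := x) refl

  1-x-injective : ∀ {x y} → 1# − x ≈ 1# − y → x ≈ y
  1-x-injective {x} {y} e = trans (sym (1-[1-x]≈x x)) (trans (+-congˡ (-‿cong e)) (1-[1-x]≈x y))

  1-x≉1 : ∀ {x} → ¬ x ≈ 0# → ¬ 1# − x ≈ 1#
  1-x≉1 {x} x≉0 e = x≉0 (trans (sym (1-[1-x]≈x x)) (trans (+-congˡ (-‿cong e)) (-‿inverseʳ 1#)))

  ⁻¹-inverseˡ : ∀ x → ¬ x ≈ 0# → x ⁻¹ * x ≈ 1#
  ⁻¹-inverseˡ x x≉0 = trans (*-comm _ _) (⁻¹-inverse x x≉0)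

  *-cancelˡ : ∀ {z x y} → ¬ z ≈ 0# → z * x ≈ z * y → x ≈ y
  *-cancelˡ {z} {x} {y} z≉0 e = begin
    x                   ≈⟨ solve 3 (λ x z z⁻¹ → x := x :* :1) refl x z (z ⁻¹) ⟩
    x * 1#              ≈⟨ *-congˡ (⁻¹-inverseˡ z z≉0) ⟨
    x * (z ⁻¹ * z)      ≈⟨ solve 3 (λ x z z⁻¹ → x :* (z⁻¹ :* z) := z⁻¹ :* (z :* x)) refl x z (z ⁻¹) ⟩
    z ⁻¹ * (z * x)      ≈⟨ *-congˡ e ⟩
    z ⁻¹ * (z * y)      ≈⟨ solve 3 (λ y z z⁻¹ → z⁻¹ :* (z :* y) := (z⁻¹ :* z) :* y) refl y z (z ⁻¹) ⟩
    (z ⁻¹ * z) * y      ≈⟨ *-congʳ (⁻¹-inverseˡ z z≉0) ⟩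
    1# * y              ≈⟨ *-identityˡ y ⟩
    y                   ∎

  x*y≈0⇒ : ∀ {x y} → x * y ≈ 0# → x ≈ 0# ⊎ y ≈ 0#
  x*y≈0⇒ {x} {y} e with x ≟ 0#
  ... | yes x≈0 = inj₁ x≈0
  ... | no x≉0  = inj₂ (*-cancelˡ x≉0 (trans e (sym (zeroʳ x))))

  *-≉0 : ∀ {x y} → ¬ x ≈ 0# → ¬ y ≈ 0# → ¬ x * y ≈ 0#
  *-≉0 x≉0 y≉0 e with x*y≈0⇒ e
  ... | inj₁ x≈0 = x≉0 x≈0
  ... | inj₂ y≈0 = y≉0 y≈0

  ⁻¹-unique : ∀ {x y} → ¬ x ≈ 0# → x * y ≈ 1# → y ≈ x ⁻¹
  ⁻¹-unique {x} x≉0 e = *-cancelˡ x≉0 (trans e (sym (⁻¹-inverse x x≉0)))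

  ⁻¹-≉0 : ∀ {x} → ¬ x ≈ 0# → ¬ x ⁻¹ ≈ 0#
  ⁻¹-≉0 {x} x≉0 e = 0≉1 (trans (sym (zeroʳ x)) (trans (*-congˡ (sym e)) (⁻¹-inverse x x≉0)))

  ⁻¹-cong : ∀ {x y} → ¬ x ≈ 0# → x ≈ y → x ⁻¹ ≈ y ⁻¹
  ⁻¹-cong {x} x≉0 x≈y =
    ⁻¹-unique (λ y≈0 → x≉0 (trans x≈y y≈0)) (trans (*-congʳ (sym x≈y)) (⁻¹-inverse x x≉0))

  ⁻¹-involutive : ∀ {x} → ¬ x ≈ 0# → x ⁻¹ ⁻¹ ≈ x
  ⁻¹-involutive {x} x≉0 = sym (⁻¹-unique (⁻¹-≉0 x≉0) (⁻¹-inverseˡ x x≉0))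

  ⁻¹-injective : ∀ {x y} → ¬ x ≈ 0# → ¬ y ≈ 0# → x ⁻¹ ≈ y ⁻¹ → x ≈ y
  ⁻¹-injective x≉0 y≉0 e =
    trans (sym (⁻¹-involutive x≉0)) (trans (⁻¹-cong (⁻¹-≉0 x≉0) e) (⁻¹-involutive y≉0))

  1⁻¹≈1 : 1# ⁻¹ ≈ 1#
  1⁻¹≈1 = sym (⁻¹-unique (λ 1≈0 → 0≉1 (sym 1≈0)) (*-identityˡ 1#))

  /-≉0 : ∀ {x y} → ¬ x ≈ 0# → ¬ y ≈ 0# → ¬ x / y ≈ 0#
  /-≉0 x≉0 y≉0 = *-≉0 x≉0 (⁻¹-≉0 y≉0)

  ⁻¹-/ : ∀ {x y} → ¬ x ≈ 0# → ¬ y ≈ 0# → (x / y) ⁻¹ ≈ y / x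
  ⁻¹-/ {x} {y} x≉0 y≉0 = sym (⁻¹-unique (/-≉0 x≉0 y≉0) (begin
    (x * y ⁻¹) * (y * x ⁻¹)  ≈⟨ solve 4 (λ x y x⁻¹ y⁻¹ → (x :* y⁻¹) :* (y :* x⁻¹) := (x :* x⁻¹) :* (y :* y⁻¹))
                                  refl x y (x ⁻¹) (y ⁻¹) ⟩
    (x * x ⁻¹) * (y * y ⁻¹)  ≈⟨ *-cong (⁻¹-inverse x x≉0) (⁻¹-inverse y y≉0) ⟩
    1# * 1#                  ≈⟨ *-identityˡ 1# ⟩
    1#                       ∎))

  IsSquare-resp : ∀ {x y} → x ≈ y → IsSquare x → IsSquare y
  IsSquare-resp x≈y (z , z²≈x) = z , trans z²≈x x≈y

  Bit-resp : ∀ i {x y} → x ≈ y → Bit i x → Bit i y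
  Bit-resp false x≈y = IsSquare-resp x≈y
  Bit-resp true  x≈y ¬□x □y = ¬□x (IsSquare-resp (sym x≈y) □y)

  IsSquare-0 : IsSquare 0#
  IsSquare-0 = 0# , zeroˡ 0#

  IsSquare-1 : IsSquare 1#
  IsSquare-1 = 1# , *-identityˡ 1#

  nonsquare⇒≉0 : ∀ {x} → ¬ IsSquare x → ¬ x ≈ 0#
  nonsquare⇒≉0 ¬□x x≈0 = ¬□x (IsSquare-resp (sym x≈0) IsSquare-0)

  IsSquare-* : ∀ {x y} → IsSquare x → IsSquare y → IsSquare (x * y)
  IsSquare-* {x} {y} (z , z²≈x) (w , w²≈y) =
    z * w , trans (solve 2 (λ z w → (z :* w) :* (z :* w) := (z :* z) :* (w :* w)) refl z w)
                  (*-cong z²≈x w²≈y)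

  IsSquare-⁻¹ : ∀ {x} → ¬ x ≈ 0# → IsSquare x → IsSquare (x ⁻¹)
  IsSquare-⁻¹ {x} x≉0 (z , z²≈x) = z * x ⁻¹ , (begin
    (z * x ⁻¹) * (z * x ⁻¹)  ≈⟨ solve 2 (λ z x⁻¹ → (z :* x⁻¹) :* (z :* x⁻¹) := ((z :* z) :* x⁻¹) :* x⁻¹)
                                  refl z (x ⁻¹) ⟩
    ((z * z) * x ⁻¹) * x ⁻¹  ≈⟨ *-congʳ (*-congʳ z²≈x) ⟩
    (x * x ⁻¹) * x ⁻¹        ≈⟨ *-congʳ (⁻¹-inverse x x≉0) ⟩
    1# * x ⁻¹                ≈⟨ *-identityˡ _ ⟩
    x ⁻¹                     ∎)

  IsSquare-cancelˡ : ∀ {x y} → ¬ x ≈ 0# → IsSquare x → IsSquare (x * y) → IsSquare y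
  IsSquare-cancelˡ {x} {y} x≉0 □x □xy =
    IsSquare-resp x⁻¹[xy]≈y (IsSquare-* (IsSquare-⁻¹ x≉0 □x) □xy)
    where
    x⁻¹[xy]≈y : x ⁻¹ * (x * y) ≈ y
    x⁻¹[xy]≈y = trans (sym (*-assoc _ _ _)) (trans (*-congʳ (⁻¹-inverseˡ x x≉0)) (*-identityˡ y))

  IsSquare-*⇒Bit-shared : ∀ i {x y} → ¬ x ≈ 0# → ¬ y ≈ 0# → IsSquare (x * y) → Bit i x → Bit i y
  IsSquare-*⇒Bit-shared false x≉0 _   □xy □x     = IsSquare-cancelˡ x≉0 □x □xy
  IsSquare-*⇒Bit-shared true  _   y≉0 □xy ¬□x □y =
    ¬□x (IsSquare-cancelˡ y≉0 □y (IsSquare-resp (*-comm _ _) □xy))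

module QuadraticCharacter {c ℓ : Level} (F : OddFiniteField c ℓ) where
  open OddFiniteField F
  open Notions F
  open FieldFacts F
  open IntegerCoefficientSolver commRing
  open Counting
  open import Data.Nat using (_≤_; _<_; s≤s; z≤n)
  open import Data.Nat.DivMod using (_%_; m*n%n≡0)
  open import Data.Fin as Fin using (Fin)
  open import Data.Fin.Properties as Fin using (<-cmp)
  open import Data.Sum using (_⊎_; inj₁; inj₂)
  open import Data.Product using (_×_)
  open import Data.Empty using (⊥-elim)
  open import Relation.Nullary using (¬?)
  open import Data.Bool using (true; false; _xor_)
  open import Function using (_∘_)
  open import Relation.Binary.Definitions using (tri<; tri≈; tri>; _Respects_)
  open import Relation.Unary using (Pred; Decidable; _∩_; ∁)
  open import Relation.Unary.Properties using (U?; _∩?_; ∁?)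
  open import Algebra.Properties.Ring ring using (-‿involutive)

  private variable
    p p′ : Level

  index : Carrier → Fin q
  index x = proj₁ (enum-surjective x)

  enum-index : ∀ x → enum (index x) ≈ x
  enum-index x = proj₂ (enum-surjective x)

  index-cong : ∀ {x y} → x ≈ y → index x ≡ index y
  index-cong {x} {y} x≈y =
    enum-injective (index x) (index y) (trans (enum-index x) (trans x≈y (sym (enum-index y))))

  index-injective : ∀ {x y} → index x ≡ index y → x ≈ y
  index-injective {x} {y} e = trans (sym (enum-index x)) (trans (reflexive (≡.cong enum e)) (enum-index y))

  ∣_∣ : {P : Pred Carrier p} → Decidable P → ℕ
  ∣ P? ∣ = count (P? ∘ enum)

  ∣∣-cong : {P : Pred Carrier p} {Q : Pred Carrier p′} (P? : Decidable P) (Q? : Decidable Q) →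
            (∀ x → P x → Q x) → (∀ x → Q x → P x) → ∣ P? ∣ ≡ ∣ Q? ∣
  ∣∣-cong P? Q? P⊆Q Q⊆P = count-cong (P? ∘ enum) (Q? ∘ enum) (P⊆Q ∘ enum) (Q⊆P ∘ enum)

  ∣∣-injection : {P : Pred Carrier p} {Q : Pred Carrier p′} (P? : Decidable P) (Q? : Decidable Q) →
    Q Respects _≈_ → (f : ∀ x → P x → Carrier) → (∀ x px → Q (f x px)) →
    (∀ x y px py → f x px ≈ f y py → x ≈ y) → ∣ P? ∣ ≤ ∣ Q? ∣
  ∣∣-injection P? Q? Q-resp f f-into f-inj =
    count-injection (P? ∘ enum) (Q? ∘ enum) (λ k pk → index (f (enum k) pk))
      (λ k pk → Q-resp (sym (enum-index _)) (f-into (enum k) pk))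
      (λ k k′ pk pk′ e → enum-injective k k′ (f-inj _ _ pk pk′ (index-injective e)))

  ∣∣-witness : {P : Pred Carrier p} (P? : Decidable P) → 0 < ∣ P? ∣ → ∃ P
  ∣∣-witness P? pos = let k , pk = count-witness (P? ∘ enum) pos in enum k , pk

  ∣∣-positive : {P : Pred Carrier p} (P? : Decidable P) → P Respects _≈_ → ∀ {x} → P x → 0 < ∣ P? ∣
  ∣∣-positive P? P-resp {x} px =
    ≡.subst (0 <_) (≡.sym (count-remove (P? ∘ enum) (P-resp (sym (enum-index x)) px))) (s≤s z≤n)

  module FixedPointFreeInvolution
    {P : Pred Carrier p} (P? : Decidable P) (P-resp : P Respects _≈_)
    (σ : Carrier → Carrier) (σ-cong : ∀ {x y} → x ≈ y → σ x ≈ σ y)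
    (σ-involutive : ∀ x → σ (σ x) ≈ x) (σ-closed : ∀ {x} → P x → P (σ x))
    (σ-fixedPointFree : ∀ {x} → P x → ¬ σ x ≈ x) where

    -- Selects one element from each orbit {x , σ x}.
    Lower : Pred Carrier Level.zero
    Lower x = index x Fin.< index (σ x)

    lower? : Decidable Lower
    lower? x = index x Fin.<? index (σ x)

    Lower-resp : Lower Respects _≈_
    Lower-resp x≈y = ≡.subst₂ Fin._<_ (index-cong x≈y) (index-cong (σ-cong x≈y))

    index-σσ : ∀ x → index (σ (σ x)) ≡ index x
    index-σσ x = index-cong (σ-involutive x)

    Lower⇒¬Lower-σ : ∀ {x} → Lower x → ¬ Lower (σ x)
    Lower⇒¬Lower-σ {x} lx lσx = Fin.<-asym lx (≡.subst (index (σ x) Fin.<_) (index-σσ x) lσx)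

    ¬Lower⇒Lower-σ : ∀ {x} → P x → ¬ Lower x → Lower (σ x)
    ¬Lower⇒Lower-σ {x} px ¬lx with <-cmp (index x) (index (σ x))
    ... | tri< lx _ _ = ⊥-elim (¬lx lx)
    ... | tri≈ _ e _  = ⊥-elim (σ-fixedPointFree px (index-injective (≡.sym e)))
    ... | tri> _ _ gt = ≡.subst (index (σ x) Fin.<_) (≡.sym (index-σσ x)) gt

    σ-injective : ∀ {x y} → σ x ≈ σ y → x ≈ y
    σ-injective {x} {y} e = trans (sym (σ-involutive x)) (trans (σ-cong e) (σ-involutive y))

    ∣P∣≡2∣P∩Lower∣ : ∣ P? ∣ ≡ ∣ P? ∩? lower? ∣ ℕ.+ ∣ P? ∩? lower? ∣
    ∣P∣≡2∣P∩Lower∣ = ≡.trans (count-split (P? ∘ enum) (lower? ∘ enum))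
      (≡.cong (∣ P? ∩? lower? ∣ ℕ.+_) (≡.sym (ℕ.≤-antisym lower≤upper upper≤lower)))
      where
      lower≤upper : ∣ P? ∩? lower? ∣ ≤ ∣ P? ∩? ∁? lower? ∣
      lower≤upper = ∣∣-injection (P? ∩? lower?) (P? ∩? ∁? lower?)
        (λ x≈y (px , ¬lx) → P-resp x≈y px , ¬lx ∘ Lower-resp (sym x≈y))
        (λ x _ → σ x) (λ x (px , lx) → σ-closed px , Lower⇒¬Lower-σ lx) (λ _ _ _ _ → σ-injective)
      upper≤lower : ∣ P? ∩? ∁? lower? ∣ ≤ ∣ P? ∩? lower? ∣
      upper≤lower = ∣∣-injection (P? ∩? ∁? lower?) (P? ∩? lower?)
        (λ x≈y (px , lx) → P-resp x≈y px , Lower-resp x≈y lx)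
        (λ x _ → σ x) (λ x (px , ¬lx) → σ-closed px , ¬Lower⇒Lower-σ px ¬lx) (λ _ _ _ _ → σ-injective)

    ∣P∣≡2∣Q∣ : {Q : Pred Carrier p′} (Q? : Decidable Q) → Q Respects _≈_ →
      (g : Carrier → Carrier) → (∀ {x y} → x ≈ y → g x ≈ g y) →
      (∀ {x} → P x → Q (g x)) → (∀ x → g (σ x) ≈ g x) →
      (∀ {x y} → P x → P y → g x ≈ g y → y ≈ x ⊎ y ≈ σ x) →
      (∀ {y} → Q y → ∃ λ x → P x × g x ≈ y) →
      ∣ P? ∣ ≡ ∣ Q? ∣ ℕ.+ ∣ Q? ∣
    ∣P∣≡2∣Q∣ {Q = Q} Q? Q-resp g g-cong g-into g-σ g-fibres g-onto =
      ≡.trans ∣P∣≡2∣P∩Lower∣ (≡.cong₂ ℕ._+_ ∣P∩Lower∣≡∣Q∣ ∣P∩Lower∣≡∣Q∣)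
      where
      representative : ∀ {x} → P x → ∃ λ r → (P r × Lower r) × g r ≈ g x
      representative {x} px with lower? x
      ... | yes lx = x , (px , lx) , refl
      ... | no ¬lx = σ x , (σ-closed px , ¬Lower⇒Lower-σ px ¬lx) , g-σ x

      lift : ∀ {y} → Q y → ∃ λ r → (P r × Lower r) × g r ≈ y
      lift qy = let x , px , gx≈y = g-onto qy
                    r , r∈ , gr≈gx = representative px
                in r , r∈ , trans gr≈gx gx≈y

      g-injective-on-Lower : ∀ x y → P x × Lower x → P y × Lower y → g x ≈ g y → x ≈ y
      g-injective-on-Lower x y (px , lx) (py , ly) e with g-fibres px py e
      ... | inj₁ y≈x  = sym y≈x
      ... | inj₂ y≈σx = ⊥-elim (Lower⇒¬Lower-σ lx (Lower-resp y≈σx ly))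

      ∣P∩Lower∣≡∣Q∣ : ∣ P? ∩? lower? ∣ ≡ ∣ Q? ∣
      ∣P∩Lower∣≡∣Q∣ = ℕ.≤-antisym
        (∣∣-injection (P? ∩? lower?) Q? Q-resp (λ x _ → g x) (λ x (px , _) → g-into px)
          g-injective-on-Lower)
        (∣∣-injection Q? (P? ∩? lower?) (λ x≈y (px , lx) → P-resp x≈y px , Lower-resp x≈y lx)
          (λ y qy → proj₁ (lift qy)) (λ y qy → proj₁ (proj₂ (lift qy)))
          (λ y y′ qy qy′ e → trans (sym (proj₂ (proj₂ (lift qy))))
                               (trans (g-cong e) (proj₂ (proj₂ (lift qy′))))))

  1+1≉0 : ¬ 1# + 1# ≈ 0#
  1+1≉0 2≈0 = 1≢0 (≡.trans (≡.sym q-odd) (≡.subst (λ n → n % 2 ≡ 0) (≡.sym q≡2m) (even m)))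
    where
    open FixedPointFreeInvolution U? (λ _ _ → _) (_+ 1#) +-congʳ
      (λ x → trans (solve 1 (λ x → (x :+ :1) :+ :1 := x :+ (:1 :+ :1)) refl x)
                   (trans (+-congˡ 2≈0) (+-identityʳ x)))
      (λ _ → _)
      (λ {x} _ x+1≈x → 0≉1 (sym (trans (solve 1 (λ x → :1 := (x :+ :1) :- x) refl x)
                                      (trans (+-congʳ x+1≈x) (-‿inverseʳ x)))))
    m : ℕ
    m = ∣ U? ∩? lower? ∣
    q≡2m : q ≡ m ℕ.+ m
    q≡2m = ≡.trans (≡.sym count-U) ∣P∣≡2∣P∩Lower∣
    even : ∀ n → (n ℕ.+ n) % 2 ≡ 0
    even n = ≡.subst (λ k → k % 2 ≡ 0) (≡.trans (ℕ.*-comm n 2) (≡.cong (n ℕ.+_) (ℕ.+-identityʳ n)))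
               (m*n%n≡0 n 2)
    1≢0 : ¬ 1 ≡ 0
    1≢0 ()

  Nonzero : Pred Carrier ℓ
  Nonzero x = ¬ x ≈ 0#

  nonzero? : Decidable Nonzero
  nonzero? x = ¬? (x ≟ 0#)

  Nonzero-resp : Nonzero Respects _≈_
  Nonzero-resp x≈y x≉0 y≈0 = x≉0 (trans x≈y y≈0)

  nonzeroSquare? : Decidable (Nonzero ∩ IsSquare)
  nonzeroSquare? = nonzero? ∩? isSquare?

  nonzeroSquare-resp : (Nonzero ∩ IsSquare) Respects _≈_
  nonzeroSquare-resp x≈y (x≉0 , □x) = Nonzero-resp x≈y x≉0 , IsSquare-resp x≈y □x

  nonsquare? : Decidable (Nonzero ∩ ∁ IsSquare)
  nonsquare? = nonzero? ∩? ∁? isSquare?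

  -x≉x : ∀ {x} → ¬ x ≈ 0# → ¬ - x ≈ x
  -x≉x {x} x≉0 -x≈x = *-≉0 1+1≉0 x≉0 (begin
    (1# + 1#) * x  ≈⟨ solve 1 (λ x → (:1 :+ :1) :* x := x :+ x) refl x ⟩
    x + x          ≈⟨ +-congˡ -x≈x ⟨
    x + - x        ≈⟨ -‿inverseʳ x ⟩
    0#             ∎)
    where open import Relation.Binary.Reasoning.Setoid setoid

  x²≈y²⇒y≈±x : ∀ {x y} → x * x ≈ y * y → y ≈ x ⊎ y ≈ - x
  x²≈y²⇒y≈±x {x} {y} x²≈y² with x*y≈0⇒ (trans [y-x][y+x]≈y²-x² (x≈y⇒x-y≈0 (sym x²≈y²)))
    where
    [y-x][y+x]≈y²-x² : (y − x) * (y + x) ≈ y * y − x * x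
    [y-x][y+x]≈y²-x² = solve 2 (λ x y → (y :- x) :* (y :+ x) := y :* y :- x :* x) refl x y
  ... | inj₁ y-x≈0 = inj₁ (x-y≈0⇒x≈y y-x≈0)
  ... | inj₂ y+x≈0 = inj₂ (x-y≈0⇒x≈y (trans (+-congˡ (-‿involutive x)) y+x≈0))

  ∣nonzero∣≡2∣nonzeroSquare∣ : ∣ nonzero? ∣ ≡ ∣ nonzeroSquare? ∣ ℕ.+ ∣ nonzeroSquare? ∣
  ∣nonzero∣≡2∣nonzeroSquare∣ = ∣P∣≡2∣Q∣ nonzeroSquare? nonzeroSquare-resp
    (λ x → x * x) (λ x≈y → *-cong x≈y x≈y)
    (λ {x} x≉0 → *-≉0 x≉0 x≉0 , (x , refl))
    (λ x → solve 1 (λ x → (:- x) :* (:- x) := x :* x) refl x)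
    (λ _ _ → x²≈y²⇒y≈±x)
    (λ { (y≉0 , z , z²≈y) → z , (λ z≈0 → y≉0 (trans (sym z²≈y) (trans (*-congʳ z≈0) (zeroˡ z))))
                              , z²≈y })
    where
    open FixedPointFreeInvolution nonzero? Nonzero-resp -_ -‿cong -‿involutive
      (λ x≉0 -x≈0 → x≉0 (-x≈0⇒x≈0 -x≈0)) -x≉x

  ∣nonsquare∣≡∣nonzeroSquare∣ : ∣ nonsquare? ∣ ≡ ∣ nonzeroSquare? ∣
  ∣nonsquare∣≡∣nonzeroSquare∣ = ℕ.+-cancelˡ-≡ ∣ nonzeroSquare? ∣ _ _
    (≡.trans (≡.sym (count-split (nonzero? ∘ enum) (isSquare? ∘ enum))) ∣nonzero∣≡2∣nonzeroSquare∣)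

  nonsquare : ∃ λ x → ¬ IsSquare x
  nonsquare =
    let x , _ , ¬□x = ∣∣-witness nonsquare? (≡.subst (0 <_) (≡.sym ∣nonsquare∣≡∣nonzeroSquare∣)
                        (∣∣-positive nonzeroSquare? nonzeroSquare-resp (1≉0 , IsSquare-1)))
    in x , ¬□x
    where
    1≉0 : ¬ 1# ≈ 0#
    1≉0 1≈0 = 0≉1 (sym 1≈0)

  -- Sending 0 to x * y and every other square z to x * z embeds the squares, 0 included,
  -- into the nonsquares, which are only as many as the nonzero squares.
  nonsquare-* : ∀ {x y} → ¬ IsSquare x → ¬ IsSquare y → IsSquare (x * y)
  nonsquare-* {x} {y} ¬□x ¬□y with isSquare? (x * y)
  ... | yes □xy = □xy
  ... | no ¬□xy = ⊥-elim (ℕ.n≮n ∣ nonzeroSquare? ∣ (begin-strict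
      ∣ nonzeroSquare? ∣                               <⟨ ℕ.m<m+n ∣ nonzeroSquare? ∣ zero-counted ⟩
      ∣ nonzeroSquare? ∣ ℕ.+ ∣ isSquare? ∩? ∁? nonzero? ∣  ≡⟨ squares-split ⟨
      ∣ isSquare? ∣                                    ≤⟨ squares↪nonsquares ⟩
      ∣ nonsquare? ∣                                   ≡⟨ ∣nonsquare∣≡∣nonzeroSquare∣ ⟩
      ∣ nonzeroSquare? ∣                               ∎))
    where
    open ℕ.≤-Reasoning
    x≉0 = nonsquare⇒≉0 ¬□x
    zero-counted : 1 ≤ ∣ isSquare? ∩? ∁? nonzero? ∣
    zero-counted = ∣∣-positive (isSquare? ∩? ∁? nonzero?)
      (λ z≈w (□z , z≈0) → IsSquare-resp z≈w □z , λ w≉0 → z≈0 (Nonzero-resp (sym z≈w) w≉0))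
      (IsSquare-0 , λ 0≉0 → 0≉0 refl)
    squares-split : ∣ isSquare? ∣ ≡ ∣ nonzeroSquare? ∣ ℕ.+ ∣ isSquare? ∩? ∁? nonzero? ∣
    squares-split = ≡.trans (count-split (isSquare? ∘ enum) (nonzero? ∘ enum))
      (≡.cong (ℕ._+ ∣ isSquare? ∩? ∁? nonzero? ∣)
        (∣∣-cong (isSquare? ∩? nonzero?) nonzeroSquare?
          (λ _ (□z , z≉0) → z≉0 , □z) (λ _ (z≉0 , □z) → □z , z≉0)))
    f : Carrier → Carrier
    f z with z ≟ 0#
    ... | yes _ = x * y
    ... | no _  = x * z
    f-into : ∀ z → IsSquare z → Nonzero (f z) × ¬ IsSquare (f z)
    f-into z □z with z ≟ 0#
    ... | yes _  = nonsquare⇒≉0 ¬□xy , ¬□xy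
    ... | no z≉0 =
      *-≉0 x≉0 z≉0 , λ □xz → ¬□x (IsSquare-cancelˡ z≉0 □z (IsSquare-resp (*-comm x z) □xz))
    f-injective : ∀ z w → IsSquare z → IsSquare w → f z ≈ f w → z ≈ w
    f-injective z w □z □w e with z ≟ 0# | w ≟ 0#
    ... | yes z≈0 | yes w≈0 = trans z≈0 (sym w≈0)
    ... | yes _   | no _    = ⊥-elim (¬□y (IsSquare-resp (sym (*-cancelˡ x≉0 e)) □w))
    ... | no _    | yes _   = ⊥-elim (¬□y (IsSquare-resp (*-cancelˡ x≉0 e) □z))
    ... | no _    | no _    = *-cancelˡ x≉0 e
    squares↪nonsquares : ∣ isSquare? ∣ ≤ ∣ nonsquare? ∣
    squares↪nonsquares = ∣∣-injection isSquare? nonsquare?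
      (λ z≈w (z≉0 , ¬□z) → Nonzero-resp z≈w z≉0 , λ □w → ¬□z (IsSquare-resp (sym z≈w) □w))
      (λ z _ → f z) f-into f-injective

  Bit-* : ∀ i j {x y} → ¬ x ≈ 0# → ¬ y ≈ 0# → Bit i x → Bit j y → Bit (i xor j) (x * y)
  Bit-* false false _   _   □x  □y  = IsSquare-* □x □y
  Bit-* false true  x≉0 _   □x  ¬□y = λ □xy → ¬□y (IsSquare-cancelˡ x≉0 □x □xy)
  Bit-* true  false _   y≉0 ¬□x □y  =
    λ □xy → ¬□x (IsSquare-cancelˡ y≉0 □y (IsSquare-resp (*-comm _ _) □xy))
  Bit-* true  true  _   _   ¬□x ¬□y = nonsquare-* ¬□x ¬□y

  Bit-same-* : ∀ i {x y} → Bit i x → Bit i y → IsSquare (x * y)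
  Bit-same-* false □x  □y  = IsSquare-* □x □y
  Bit-same-* true  ¬□x ¬□y = nonsquare-* ¬□x ¬□y

module PsiMap {c ℓ : Level} (F : OddFiniteField c ℓ) where
  open OddFiniteField F
  open Notions F
  open FieldFacts F
  open IntegerCoefficientSolver commRing
  open import Data.Bool using (Bool; true; false; not; if_then_else_)
  open import Data.Empty using (⊥-elim)
  open import Relation.Nullary using (does)
  open import Relation.Binary.Reasoning.Setoid setoid

  bit : Carrier → Bool
  bit x = not (does (isSquare? x))

  Bit-bit : ∀ x → Bit (bit x) x
  Bit-bit x with isSquare? x
  ... | yes □x = □x
  ... | no ¬□x = ¬□x

  Bit-unique : ∀ i j {x} → Bit i x → Bit j x → i ≡ j
  Bit-unique false false □x  _   = ≡.refl
  Bit-unique true  true  ¬□x _   = ≡.refl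
  Bit-unique false true  □x  ¬□x = ⊥-elim (¬□x □x)
  Bit-unique true  false ¬□x □x  = ⊥-elim (¬□x □x)

  bit-Bit : ∀ {i x} → Bit i x → bit x ≡ i
  bit-Bit {i} {x} = Bit-unique (bit x) i (Bit-bit x)

  bit-cong : ∀ {x y} → x ≈ y → bit x ≡ bit y
  bit-cong {x} x≈y = ≡.sym (bit-Bit (Bit-resp (bit x) x≈y (Bit-bit x)))

  slope : Carrier → Carrier → Carrier → Carrier
  slope a b z = if bit z then b else a

  slope-≡ : ∀ a b {x y} → bit x ≡ bit y → slope a b x ≡ slope a b y
  slope-≡ a b = ≡.cong (λ i → if i then b else a)

  ψ≈slope* : ∀ a b z → ψ a b z ≈ slope a b z * z
  ψ≈slope* a b z with isSquare? z
  ... | yes _ = refl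
  ... | no  _ = refl

  ψ-Bit : ∀ a b {i z} → Bit i z → ψ a b z ≈ (if i then b else a) * z
  ψ-Bit a b {z = z} bz =
    trans (ψ≈slope* a b z) (reflexive (≡.cong (λ i → (if i then b else a) * z) (bit-Bit bz)))

  ψ-cong : ∀ a b {x y} → x ≈ y → ψ a b x ≈ ψ a b y
  ψ-cong a b {x} {y} x≈y = begin
    ψ a b x             ≈⟨ ψ≈slope* a b x ⟩
    slope a b x * x     ≈⟨ *-cong (reflexive (slope-≡ a b (bit-cong x≈y))) x≈y ⟩
    slope a b y * y     ≈⟨ ψ≈slope* a b y ⟨
    ψ a b y             ∎

  ψ-0 : ∀ a b {x} → x ≈ 0# → ψ a b x ≈ 0#
  ψ-0 a b {x} x≈0 = trans (ψ≈slope* a b x) (trans (*-congˡ x≈0) (zeroʳ _))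

  ψ-1- : ∀ a b z → ψ (1# − a) (1# − b) z ≈ z − ψ a b z
  ψ-1- a b z with isSquare? z
  ... | yes _ = solve 2 (λ a z → (:1 :- a) :* z := z :- a :* z) refl a z
  ... | no  _ = solve 2 (λ b z → (:1 :- b) :* z := z :- b :* z) refl b z

module ComplementSymmetry {c ℓ : Level} (F : OddFiniteField c ℓ) where
  open OddFiniteField F
  open Notions F
  open FieldFacts F
  open PsiMap F
  open IntegerCoefficientSolver commRing
  open import Algebra.Properties.Ring ring using (-‿involutive)
  open import Relation.Binary.Reasoning.Setoid setoid

  InΣ-complement : ∀ {a b} → InΣ a b → InΣ (1# − a) (1# − b)
  InΣ-complement {a} {b} (a≉b , a≉0 , a≉1 , b≉0 , b≉1 , □ab , □[1-a][1-b]) =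
    a≉b ∘ 1-x-injective , 1-x≉0 a≉1 , 1-x≉1 a≉0 , 1-x≉0 b≉1 , 1-x≉1 b≉0 , □[1-a][1-b] ,
    IsSquare-resp (sym (*-cong (1-[1-x]≈x a) (1-[1-x]≈x b))) □ab
    where open import Function using (_∘_)

  module _ {a b u v : Carrier} where
    private
      ψ′ = ψ (1# − a) (1# − b)
      ψ₀ = ψ a b

    complement-ψu-v : ψ′ (- v) − (- u) ≈ u − v − ψ₀ (- v)
    complement-ψu-v = begin
      ψ′ (- v) − (- u)              ≈⟨ +-congʳ (ψ-1- a b (- v)) ⟩
      (- v − ψ₀ (- v)) − (- u)      ≈⟨ solve 3 (λ u v p → ((:- v) :- p) :- (:- u) := u :- v :- p)
                                             refl u v (ψ₀ (- v)) ⟩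
      u − v − ψ₀ (- v)              ∎

    complement-u-v-ψ[-v] : - v − (- u) − ψ′ (- (- u)) ≈ ψ₀ u − v
    complement-u-v-ψ[-v] = begin
      - v − (- u) − ψ′ (- (- u))    ≈⟨ +-congˡ (-‿cong (trans (ψ-cong _ _ (-‿involutive u)) (ψ-1- a b u))) ⟩
      - v − (- u) − (u − ψ₀ u)      ≈⟨ solve 3 (λ u v p → (:- v) :- (:- u) :- (u :- p) := p :- v)
                                             refl u v (ψ₀ u) ⟩
      ψ₀ u − v                      ∎

    InE-complement : InE a b u v → InE (1# − a) (1# − b) (- v) (- u)
    InE-complement (not-both-0 , eqn) =
      (λ (-v≈0 , -u≈0) → not-both-0 (-x≈0⇒x≈0 -u≈0 , -x≈0⇒x≈0 -v≈0)) , (begin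
      ψ′ (ψ′ (- v) − (- u))
        ≈⟨ ψ-cong _ _ complement-ψu-v ⟩
      ψ′ (u − v − ψ₀ (- v))
        ≈⟨ ψ-1- a b _ ⟩
      u − v − ψ₀ (- v) − ψ₀ (u − v − ψ₀ (- v))
        ≈⟨ solve 5 (λ u v p q r → u :- v :- q :- r := (u :- p) :+ ((p :- v) :- (q :+ r)))
                   refl u v (ψ₀ u) (ψ₀ (- v)) (ψ₀ (u − v − ψ₀ (- v))) ⟩
      (u − ψ₀ u) + (ψ₀ u − v − (ψ₀ (- v) + ψ₀ (u − v − ψ₀ (- v))))
        ≈⟨ +-congˡ (+-congˡ (-‿cong eqn)) ⟨
      (u − ψ₀ u) + (ψ₀ u − v − ψ₀ (ψ₀ u − v))
        ≈⟨ +-cong (ψ-1- a b u) (ψ-1- a b _) ⟨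
      ψ′ u + ψ′ (ψ₀ u − v)
        ≈⟨ +-cong (ψ-cong _ _ (-‿involutive u)) (ψ-cong _ _ complement-u-v-ψ[-v]) ⟨
      ψ′ (- (- u)) + ψ′ (- v − (- u) − ψ′ (- (- u))) ∎)

    InEijrs-complement : ∀ {i j r s} → InEijrs i j r s a b u v →
                         InEijrs j i s r (1# − a) (1# − b) (- v) (- u)
    InEijrs-complement {i} {s = s} (e , bu , b[-v] , b[ψu-v] , b[u-v-ψ[-v]]) =
      InE-complement e , b[-v] , Bit-resp i (sym (-‿involutive u)) bu ,
      Bit-resp s (sym complement-ψu-v) b[u-v-ψ[-v]] , Bit-resp _ (sym complement-u-v-ψ[-v]) b[ψu-v]

module Nonvanishing {c ℓ : Level} (F : OddFiniteField c ℓ) where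
  open OddFiniteField F
  open Notions F
  open FieldFacts F
  open QuadraticCharacter F using (Bit-*; Bit-same-*)
  open PsiMap F
  open ComplementSymmetry F
  open IntegerCoefficientSolver commRing
  open import Data.Bool using (true; false; not; _xor_)
  open import Data.Sum using (_⊎_; inj₁; inj₂; [_,_]′)
  open import Data.Empty using (⊥; ⊥-elim)
  open import Algebra.Properties.Ring ring using (-0#≈0#)
  open import Relation.Binary.Reasoning.Setoid setoid

  α[1-α+αβ]≈αβ⇒[1-α][1-β]≈0 : ∀ {α β} → ¬ α ≈ 0# → α * (1# − α + α * β) ≈ α * β →
                               (1# − α) * (1# − β) ≈ 0#
  α[1-α+αβ]≈αβ⇒[1-α][1-β]≈0 {α} {β} α≉0 e = begin
    (1# − α) * (1# − β)  ≈⟨ solve 2 (λ α β → (:1 :- α) :* (:1 :- β) := (:1 :- α :+ α :* β) :- β) refl α β ⟩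
    (1# − α + α * β) − β ≈⟨ x≈y⇒x-y≈0 (*-cancelˡ α≉0 e) ⟩
    0#                   ∎

  γ[1-α+αγ]≈αγ⇒α[1-α][1-γ]≈[1-α]² : ∀ {α γ} → ¬ γ ≈ 0# → γ * (1# − α + α * γ) ≈ α * γ →
                                    α * ((1# − α) * (1# − γ)) ≈ (1# − α) * (1# − α)
  γ[1-α+αγ]≈αγ⇒α[1-α][1-γ]≈[1-α]² {α} {γ} γ≉0 e = begin
    α * ((1# − α) * (1# − γ))  ≈⟨ solve 2 (λ α γ → α :* ((:1 :- α) :* (:1 :- γ)) := (:1 :- α) :* (α :- α :* γ))
                                          refl α γ ⟩
    (1# − α) * (α − α * γ)      ≈⟨ *-congˡ (+-congʳ (*-cancelˡ γ≉0 (trans e (*-comm α γ)))) ⟨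
    (1# − α) * ((1# − α + α * γ) − α * γ)
                                ≈⟨ *-congˡ (solve 2 (λ α γ → (:1 :- α :+ α :* γ) :- α :* γ := :1 :- α) refl α γ) ⟩
    (1# − α) * (1# − α)         ∎

  γ[1-α+α²]≈α²⇒γ[1-α][1-γ]≈[α[1-γ]]² : ∀ {α γ} → γ * (1# − α + α * α) ≈ α * α →
                                       γ * ((1# − α) * (1# − γ)) ≈ (α * (1# − γ)) * (α * (1# − γ))
  γ[1-α+α²]≈α²⇒γ[1-α][1-γ]≈[α[1-γ]]² {α} {γ} e = begin
    γ * ((1# − α) * (1# − γ))
      ≈⟨ solve 2 (λ α γ → γ :* ((:1 :- α) :* (:1 :- γ))
                       := (γ :* (:1 :- α :+ α :* α) :- γ :* (α :* α)) :* (:1 :- γ)) refl α γ ⟩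
    (γ * (1# − α + α * α) − γ * (α * α)) * (1# − γ)
      ≈⟨ *-congʳ (+-congʳ e) ⟩
    (α * α − γ * (α * α)) * (1# − γ)
      ≈⟨ solve 2 (λ α γ → (α :* α :- γ :* (α :* α)) :* (:1 :- γ)
                       := (α :* (:1 :- γ)) :* (α :* (:1 :- γ))) refl α γ ⟩
    (α * (1# − γ)) * (α * (1# − γ)) ∎

  Bool-dichotomy : ∀ k {i j} → not j ≡ i → k ≡ i ⊎ k ≡ j
  Bool-dichotomy false {false} _         = inj₁ ≡.refl
  Bool-dichotomy true  {true}  _         = inj₁ ≡.refl
  Bool-dichotomy false {true}  {false} _ = inj₂ ≡.refl
  Bool-dichotomy true  {false} {true}  _ = inj₂ ≡.refl

  module _ {a b : Carrier} (Σab : InΣ a b) where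
    private
      a≉0 : ¬ a ≈ 0#
      a≉0 = let (_ , a≉0 , _) = Σab in a≉0
      a≉1 : ¬ a ≈ 1#
      a≉1 = let (_ , _ , a≉1 , _) = Σab in a≉1
      b≉0 : ¬ b ≈ 0#
      b≉0 = let (_ , _ , _ , b≉0 , _) = Σab in b≉0
      b≉1 : ¬ b ≈ 1#
      b≉1 = let (_ , _ , _ , _ , b≉1 , _) = Σab in b≉1
      □ab : IsSquare (a * b)
      □ab = let (_ , _ , _ , _ , _ , □ab , _) = Σab in □ab
      □[1-a][1-b] : IsSquare ((1# − a) * (1# − b))
      □[1-a][1-b] = let (_ , _ , _ , _ , _ , _ , □[1-a][1-b]) = Σab in □[1-a][1-b]

    slope-≉0 : ∀ z → ¬ slope a b z ≈ 0#
    slope-≉0 z with bit z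
    ... | false = a≉0
    ... | true  = b≉0

    slope-≉1 : ∀ z → ¬ slope a b z ≈ 1#
    slope-≉1 z with bit z
    ... | false = a≉1
    ... | true  = b≉1

    ψ≈0⇒≈0 : ∀ {z} → ψ a b z ≈ 0# → z ≈ 0#
    ψ≈0⇒≈0 {z} ψz≈0 with x*y≈0⇒ (trans (sym (ψ≈slope* a b z)) ψz≈0)
    ... | inj₁ slope≈0 = ⊥-elim (slope-≉0 z slope≈0)
    ... | inj₂ z≈0     = z≈0

    ψ≈id⇒≈0 : ∀ {z} → ψ a b z ≈ z → z ≈ 0#
    ψ≈id⇒≈0 {z} ψz≈z with x*y≈0⇒ (trans [slope-1]z≈ψz-z (x≈y⇒x-y≈0 ψz≈z))
      where
      [slope-1]z≈ψz-z : (slope a b z − 1#) * z ≈ ψ a b z − z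
      [slope-1]z≈ψz-z = trans (solve 2 (λ s z → (s :- :1) :* z := s :* z :- z) refl (slope a b z) z)
                              (+-congʳ (sym (ψ≈slope* a b z)))
    ... | inj₁ slope-1≈0 = ⊥-elim (slope-≉1 z (x-y≈0⇒x≈y slope-1≈0))
    ... | inj₂ z≈0       = z≈0

    Bit-slope : ∀ {χ} → Bit χ a → ∀ z → Bit χ (slope a b z)
    Bit-slope {χ} Bit-a z with bit z
    ... | false = Bit-a
    ... | true  = IsSquare-*⇒Bit-shared χ a≉0 b≉0 □ab Bit-a

    □[1-slope][1-slope] : ∀ {x y} → not (bit y) ≡ bit x →
                          IsSquare ((1# − slope a b x) * (1# − slope a b y))
    □[1-slope][1-slope] {x} {y} e with bit x | bit y
    □[1-slope][1-slope] e | false | true  = □[1-a][1-b]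
    □[1-slope][1-slope] e | true  | false = IsSquare-resp (*-comm _ _) □[1-a][1-b]

    module _ {u v : Carrier} (E : InE a b u v) where
      private
        ψ₀ = ψ a b
        not-both-0 = proj₁ E
        equation : ψ₀ (ψ₀ u − v) ≈ ψ₀ (- v) + ψ₀ (u − v − ψ₀ (- v))
        equation = proj₂ E

      u≉0 : ¬ u ≈ 0#
      u≉0 u≈0 = not-both-0 (u≈0 , -x≈0⇒x≈0 -v≈0)
        where
        ψu-v≈-v : ψ₀ u − v ≈ - v
        ψu-v≈-v = trans (+-congʳ (ψ-0 a b u≈0)) (+-identityˡ _)
        ψ[u-v-ψ[-v]]≈0 : ψ₀ (u − v − ψ₀ (- v)) ≈ 0#
        ψ[u-v-ψ[-v]]≈0 = +-cancelˡ (trans (sym equation) (trans (ψ-cong a b ψu-v≈-v) (sym (+-identityʳ _))))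
        -v-ψ[-v]≈0 : - v − ψ₀ (- v) ≈ 0#
        -v-ψ[-v]≈0 = trans (sym (+-congʳ (trans (+-congʳ u≈0) (+-identityˡ (- v)))))
                           (ψ≈0⇒≈0 ψ[u-v-ψ[-v]]≈0)
        -v≈0 : - v ≈ 0#
        -v≈0 = ψ≈id⇒≈0 (sym (x-y≈0⇒x≈y -v-ψ[-v]≈0))

      v≉0 : ¬ v ≈ 0#
      v≉0 v≈0 = not-both-0 (ψ≈0⇒≈0 (ψ≈id⇒≈0 ψψu≈ψu) , v≈0)
        where
        -v≈0 : - v ≈ 0#
        -v≈0 = trans (-‿cong v≈0) -0#≈0#
        x-v≈x : ∀ x → x − v ≈ x
        x-v≈x x = trans (+-congˡ -v≈0) (+-identityʳ x)
        u-v-ψ[-v]≈u : u − v − ψ₀ (- v) ≈ u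
        u-v-ψ[-v]≈u = trans (+-cong (x-v≈x u) (trans (-‿cong (ψ-0 a b -v≈0)) -0#≈0#)) (+-identityʳ u)
        ψψu≈ψu : ψ₀ (ψ₀ u) ≈ ψ₀ u
        ψψu≈ψu = begin
          ψ₀ (ψ₀ u)                            ≈⟨ ψ-cong a b (x-v≈x (ψ₀ u)) ⟨
          ψ₀ (ψ₀ u − v)                        ≈⟨ equation ⟩
          ψ₀ (- v) + ψ₀ (u − v − ψ₀ (- v))     ≈⟨ +-cong (ψ-0 a b -v≈0) (ψ-cong a b u-v-ψ[-v]≈u) ⟩
          0# + ψ₀ u                            ≈⟨ +-identityˡ _ ⟩
          ψ₀ u                                 ∎

      module _ (ψu-v≈0 : ψ₀ u − v ≈ 0#) where
        private
          t = u − v − ψ₀ (- v)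
          α = slope a b u
          β = slope a b (- v)
          γ = slope a b t

          v≈αu : v ≈ α * u
          v≈αu = trans (sym (x-y≈0⇒x≈y ψu-v≈0)) (ψ≈slope* a b u)

          ψ[-v]≈β[-αu] : ψ₀ (- v) ≈ β * (- (α * u))
          ψ[-v]≈β[-αu] = trans (ψ≈slope* a b (- v)) (*-congˡ (-‿cong v≈αu))

          t≈[1-α+αβ]u : t ≈ (1# − α + α * β) * u
          t≈[1-α+αβ]u = begin
            u − v − ψ₀ (- v)             ≈⟨ +-cong (+-congˡ (-‿cong v≈αu)) (-‿cong ψ[-v]≈β[-αu]) ⟩
            u − α * u − β * (- (α * u))  ≈⟨ solve 3 (λ α β u → u :- α :* u :- β :* (:- (α :* u))
                                                           := (:1 :- α :+ α :* β) :* u) refl α β u ⟩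
            (1# − α + α * β) * u         ∎

          γt≈αβu : γ * t ≈ (α * β) * u
          γt≈αβu = begin
            γ * t                 ≈⟨ ψ≈slope* a b t ⟨
            ψ₀ t                  ≈⟨ x+y≈0⇒y≈-x (trans (sym equation) (ψ-0 a b ψu-v≈0)) ⟩
            - ψ₀ (- v)            ≈⟨ -‿cong ψ[-v]≈β[-αu] ⟩
            - (β * (- (α * u)))   ≈⟨ solve 3 (λ α β u → :- (β :* (:- (α :* u))) := (α :* β) :* u) refl α β u ⟩
            (α * β) * u           ∎

          γ[1-α+αβ]≈αβ : γ * (1# − α + α * β) ≈ α * β
          γ[1-α+αβ]≈αβ = *-cancelˡ u≉0 (begin
            u * (γ * (1# − α + α * β))  ≈⟨ solve 3 (λ u γ x → u :* (γ :* x) := γ :* (x :* u)) refl u γ _ ⟩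
            γ * ((1# − α + α * β) * u)  ≈⟨ *-congˡ t≈[1-α+αβ]u ⟨
            γ * t                       ≈⟨ γt≈αβu ⟩
            (α * β) * u                 ≈⟨ *-comm _ _ ⟩
            u * (α * β)                 ∎)

          t≉0 : ¬ t ≈ 0#
          t≉0 t≈0 = *-≉0 (*-≉0 (slope-≉0 u) (slope-≉0 (- v))) u≉0
                         (trans (sym γt≈αβu) (trans (*-congˡ t≈0) (zeroʳ γ)))

        -- α, β, γ all lie in the square class χ of a and b, so γt = αβu forces the class of t
        -- to be that of u shifted by χ.
        t-class : ∀ χ → Bit χ a → χ xor bit t ≡ bit u
        t-class χ Bit-a = Bit-unique (χ xor bit t) (bit u)
          (Bit-* χ (bit t) (slope-≉0 t) t≉0 (Bit-slope Bit-a t) (Bit-bit t))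
          (Bit-resp (bit u) (sym γt≈αβu)
            (Bit-* false (bit u) (*-≉0 (slope-≉0 u) (slope-≉0 (- v))) u≉0
              (Bit-same-* χ (Bit-slope Bit-a u) (Bit-slope Bit-a (- v))) (Bit-bit u)))

        t-class-impossible : ∀ χ → Bit χ a → χ xor bit t ≡ bit u → ⊥
        t-class-impossible false _ bit-t≡bit-u =
          [ 1-x≉0 (slope-≉1 u) , 1-x≉0 (slope-≉1 (- v)) ]′
            (x*y≈0⇒ (α[1-α+αβ]≈αβ⇒[1-α][1-β]≈0 (slope-≉0 u)
              (≡.subst (λ γ → γ * (1# − α + α * β) ≈ α * β) (slope-≡ a b bit-t≡bit-u) γ[1-α+αβ]≈αβ)))
        t-class-impossible true ¬□a not-bit-t≡bit-u =
          [ case-β≡α , case-β≡γ ]′ (Bool-dichotomy (bit (- v)) not-bit-t≡bit-u)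
          where
          S≉0 : ¬ (1# − α) * (1# − γ) ≈ 0#
          S≉0 = *-≉0 (1-x≉0 (slope-≉1 u)) (1-x≉0 (slope-≉1 t))
          □-cancel-S : ∀ {z} → IsSquare (z * ((1# − α) * (1# − γ))) → IsSquare z
          □-cancel-S □zS = IsSquare-cancelˡ S≉0 (□[1-slope][1-slope] not-bit-t≡bit-u)
                                              (IsSquare-resp (*-comm _ _) □zS)
          with-β : ∀ {δ} → β ≡ δ → γ * (1# − α + α * δ) ≈ α * δ
          with-β β≡δ = ≡.subst (λ β → γ * (1# − α + α * β) ≈ α * β) β≡δ γ[1-α+αβ]≈αβ
          case-β≡α : bit (- v) ≡ bit u → ⊥
          case-β≡α e = Bit-slope ¬□a t (□-cancel-S
            (_ , sym (γ[1-α+α²]≈α²⇒γ[1-α][1-γ]≈[α[1-γ]]² (with-β (slope-≡ a b e)))))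
          case-β≡γ : bit (- v) ≡ bit t → ⊥
          case-β≡γ e = Bit-slope ¬□a u (□-cancel-S
            (_ , sym (γ[1-α+αγ]≈αγ⇒α[1-α][1-γ]≈[1-α]² (slope-≉0 t) (with-β (slope-≡ a b e)))))

      ψu-v≉0 : ¬ ψ₀ u − v ≈ 0#
      ψu-v≉0 ψu-v≈0 =
        t-class-impossible ψu-v≈0 (bit a) (Bit-bit a) (t-class ψu-v≈0 (bit a) (Bit-bit a))

  u-v-ψ[-v]≉0 : ∀ {a b u v} → InΣ a b → InE a b u v → ¬ u − v − ψ a b (- v) ≈ 0#
  u-v-ψ[-v]≉0 Σab E t≈0 =
    ψu-v≉0 (InΣ-complement Σab) (InE-complement E) (trans complement-ψu-v t≈0)

module NonsquareScaling {c ℓ : Level} (F : OddFiniteField c ℓ) where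
  open OddFiniteField F
  open Notions F
  open FieldFacts F
  open QuadraticCharacter F using (Bit-*)
  open PsiMap F
  open Nonvanishing F
  open IntegerCoefficientSolver commRing
  open import Data.Bool using (true; false; not; if_then_else_)
  open import Relation.Binary.Reasoning.Setoid setoid

  InΣ-flip : ∀ {a b} → InΣ a b → InΣ b a
  InΣ-flip (a≉b , a≉0 , a≉1 , b≉0 , b≉1 , □ab , □[1-a][1-b]) =
    (λ b≈a → a≉b (sym b≈a)) , b≉0 , b≉1 , a≉0 , a≉1 ,
    IsSquare-resp (*-comm _ _) □ab , IsSquare-resp (*-comm _ _) □[1-a][1-b]

  module _ {κ : Carrier} (¬□κ : ¬ IsSquare κ) where
    private
      κ≉0 : ¬ κ ≈ 0#
      κ≉0 = nonsquare⇒≉0 ¬□κ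

    Bit-flip : ∀ i {z} → ¬ z ≈ 0# → Bit i z → Bit (not i) (κ * z)
    Bit-flip i z≉0 = Bit-* true i κ≉0 z≉0 ¬□κ

    ψ-scale : ∀ a b z → ψ b a (κ * z) ≈ κ * ψ a b z
    ψ-scale a b z with z ≟ 0#
    ... | yes z≈0 = trans (ψ-0 b a (trans (*-congˡ z≈0) (zeroʳ κ)))
                          (sym (trans (*-congˡ (ψ-0 a b z≈0)) (zeroʳ κ)))
    ... | no z≉0 = begin
      ψ b a (κ * z)                              ≈⟨ ψ-Bit b a (Bit-flip (bit z) z≉0 (Bit-bit z)) ⟩
      (if not (bit z) then a else b) * (κ * z)   ≈⟨ *-congʳ (reflexive (if-not (bit z))) ⟩
      slope a b z * (κ * z)                      ≈⟨ solve 3 (λ s κ z → s :* (κ :* z) := κ :* (s :* z))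
                                                      refl (slope a b z) κ z ⟩
      κ * (slope a b z * z)                      ≈⟨ *-congˡ (ψ≈slope* a b z) ⟨
      κ * ψ a b z                                ∎
      where
      if-not : ∀ i → (if not i then a else b) ≡ (if i then b else a)
      if-not false = ≡.refl
      if-not true  = ≡.refl

    module _ {a b u v : Carrier} where
      private
        ψ₀ = ψ a b
        ψ′ = ψ b a

      scale-neg : - (κ * v) ≈ κ * (- v)
      scale-neg = solve 2 (λ κ v → :- (κ :* v) := κ :* (:- v)) refl κ v

      scale-ψu-v : ψ′ (κ * u) − κ * v ≈ κ * (ψ₀ u − v)
      scale-ψu-v = trans (+-congʳ (ψ-scale a b u))
                         (solve 3 (λ κ p v → κ :* p :- κ :* v := κ :* (p :- v)) refl κ (ψ₀ u) v)

      scale-ψ[-v] : ψ′ (- (κ * v)) ≈ κ * ψ₀ (- v)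
      scale-ψ[-v] = trans (ψ-cong b a scale-neg) (ψ-scale a b (- v))

      scale-u-v-ψ[-v] : κ * u − κ * v − ψ′ (- (κ * v)) ≈ κ * (u − v − ψ₀ (- v))
      scale-u-v-ψ[-v] = trans (+-congˡ (-‿cong scale-ψ[-v]))
        (solve 4 (λ κ u v p → κ :* u :- κ :* v :- κ :* p := κ :* (u :- v :- p)) refl κ u v (ψ₀ (- v)))

      InE-scale : InE a b u v → InE b a (κ * u) (κ * v)
      InE-scale (not-both-0 , equation) =
        (λ (κu≈0 , κv≈0) → not-both-0 (*-cancelˡ κ≉0 (trans κu≈0 (sym (zeroʳ κ))) ,
                                       *-cancelˡ κ≉0 (trans κv≈0 (sym (zeroʳ κ))))) , (begin
        ψ′ (ψ′ (κ * u) − κ * v)                        ≈⟨ ψ-cong b a scale-ψu-v ⟩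
        ψ′ (κ * (ψ₀ u − v))                            ≈⟨ ψ-scale a b _ ⟩
        κ * ψ₀ (ψ₀ u − v)                              ≈⟨ *-congˡ equation ⟩
        κ * (ψ₀ (- v) + ψ₀ (u − v − ψ₀ (- v)))         ≈⟨ distribˡ κ _ _ ⟩
        κ * ψ₀ (- v) + κ * ψ₀ (u − v − ψ₀ (- v))
          ≈⟨ +-cong scale-ψ[-v] (trans (ψ-cong b a scale-u-v-ψ[-v]) (ψ-scale a b _)) ⟨
        ψ′ (- (κ * v)) + ψ′ (κ * u − κ * v − ψ′ (- (κ * v))) ∎)

      InEijrs-scale : ∀ {i j r s} → InΣ a b → InEijrs i j r s a b u v →
                      InEijrs (not i) (not j) (not r) (not s) b a (κ * u) (κ * v)
      InEijrs-scale {i} {j} {r} {s} Σab (E , bu , b[-v] , b[ψu-v] , b[u-v-ψ[-v]]) =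
        InE-scale E ,
        Bit-flip i (u≉0 Σab E) bu ,
        Bit-resp (not j) (sym scale-neg)
          (Bit-flip j (λ -v≈0 → v≉0 Σab E (-x≈0⇒x≈0 -v≈0)) b[-v]) ,
        Bit-resp (not r) (sym scale-ψu-v) (Bit-flip r (ψu-v≉0 Σab E) b[ψu-v]) ,
        Bit-resp (not s) (sym scale-u-v-ψ[-v]) (Bit-flip s (u-v-ψ[-v]≉0 Σab E) b[u-v-ψ[-v]])

module SymmetriesOfS {c ℓ : Level} (F : OddFiniteField c ℓ) where
  open OddFiniteField F
  open Notions F
  open FieldFacts F
  open QuadraticCharacter F using (nonsquare)
  open ComplementSymmetry F
  open NonsquareScaling F
  open import Data.Bool using (not)
  open import Data.Bool.Properties using (not-involutive)

  InSijrs-resp : ∀ {i j r s x y x′ y′} → x ≈ x′ → y ≈ y′ → InSijrs i j r s x y → InSijrs i j r s x′ y′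
  InSijrs-resp x≈x′ y≈y′ (a , b , Σab , x≈ , y≈) = a , b , Σab , trans (sym x≈x′) x≈ , trans (sym y≈y′) y≈

  InSijrs-swap : ∀ {i j r s x y} → InSijrs i j r s x y → InSijrs j i s r y x
  InSijrs-swap (a , b , (Σab@(_ , _ , _ , b≉0 , _) , u , v , E) , x≈a/b , y≈[1-a]/[1-b]) =
    1# − a , 1# − b , (InΣ-complement Σab , - v , - u , InEijrs-complement E) , y≈[1-a]/[1-b] ,
    trans x≈a/b (*-cong (sym (1-[1-x]≈x a)) (⁻¹-cong b≉0 (sym (1-[1-x]≈x b))))

  InSijrs-⁻¹ : ∀ {i j r s x y} → InSijrs i j r s x y →
               InSijrs (not i) (not j) (not r) (not s) (x ⁻¹) (y ⁻¹)
  InSijrs-⁻¹ (a , b , (Σab@(_ , a≉0 , a≉1 , b≉0 , b≉1 , _) , u , v , E) , x≈a/b , y≈[1-a]/[1-b]) =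
    b , a , (InΣ-flip Σab , κ * u , κ * v , InEijrs-scale ¬□κ Σab E) ,
    inverse-of-quotient a≉0 b≉0 x≈a/b , inverse-of-quotient (1-x≉0 a≉1) (1-x≉0 b≉1) y≈[1-a]/[1-b]
    where
    κ = proj₁ nonsquare
    ¬□κ = proj₂ nonsquare
    inverse-of-quotient : ∀ {z p q} → ¬ p ≈ 0# → ¬ q ≈ 0# → z ≈ p / q → z ⁻¹ ≈ q / p
    inverse-of-quotient p≉0 q≉0 z≈p/q =
      trans (⁻¹-cong (λ z≈0 → /-≉0 p≉0 q≉0 (trans (sym z≈p/q) z≈0)) z≈p/q) (⁻¹-/ p≉0 q≉0)

  InSijrs-unflip : ∀ {i j r s x y} → InSijrs (not (not i)) (not (not j)) (not (not r)) (not (not s)) x y →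
                   InSijrs i j r s x y
  InSijrs-unflip {i} {j} {r} {s}
    rewrite not-involutive i | not-involutive j | not-involutive r | not-involutive s = λ h → h

  InS-swap : ∀ {x y} → InS x y → InS y x
  InS-swap (□x , □y , x≉y , x≉0 , x≉1 , y≉0 , y≉1) =
    □y , □x , (λ y≈x → x≉y (sym y≈x)) , y≉0 , y≉1 , x≉0 , x≉1

  InS-⁻¹ : ∀ {x y} → InS x y → InS (x ⁻¹) (y ⁻¹)
  InS-⁻¹ (□x , □y , x≉y , x≉0 , x≉1 , y≉0 , y≉1) =
    IsSquare-⁻¹ x≉0 □x , IsSquare-⁻¹ y≉0 □y , (λ e → x≉y (⁻¹-injective x≉0 y≉0 e)) ,
    ⁻¹-≉0 x≉0 , ⁻¹≉1 x≉0 x≉1 , ⁻¹-≉0 y≉0 , ⁻¹≉1 y≉0 y≉1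
    where
    ⁻¹≉1 : ∀ {z} → ¬ z ≈ 0# → ¬ z ≈ 1# → ¬ z ⁻¹ ≈ 1#
    ⁻¹≉1 z≉0 z≉1 e = z≉1 (⁻¹-injective z≉0 (λ 1≈0 → 0≉1 (sym 1≈0)) (trans e (sym 1⁻¹≈1)))

  swap-permutes-S : Permutes (λ p → (proj₂ p , proj₁ p))
  swap-permutes-S =
    (λ _ _ → InS-swap) , (λ _ _ _ _ _ _ y≈y′ x≈x′ → x≈x′ , y≈y′) ,
    (λ x y Sxy → y , x , InS-swap Sxy , refl , refl)

  ⁻¹-permutes-S : Permutes (λ p → (proj₁ p ⁻¹ , proj₂ p ⁻¹))
  ⁻¹-permutes-S =
    (λ _ _ → InS-⁻¹) ,
    (λ { _ _ _ _ (_ , _ , _ , x≉0 , _ , y≉0 , _) (_ , _ , _ , x′≉0 , _ , y′≉0 , _) e₁ e₂ →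
           ⁻¹-injective x≉0 x′≉0 e₁ , ⁻¹-injective y≉0 y′≉0 e₂ }) ,
    (λ { x y Sxy@(_ , _ , _ , x≉0 , _ , y≉0 , _) →
           x ⁻¹ , y ⁻¹ , InS-⁻¹ Sxy , ⁻¹-involutive x≉0 , ⁻¹-involutive y≉0 })

open import Data.Bool using (Bool; not)
open import Data.Product using (_×_)
open import Function using (_∘_)
open import Function.Bundles using (_⇔_; mk⇔)

proposition2p3 : ∀ {c ℓ : Level} (F : OddFiniteField c ℓ) →
    let open OddFiniteField F
        open Notions F
    in Permutes (λ p → (proj₂ p , proj₁ p))
     × Permutes (λ p → ((proj₁ p) ⁻¹ , (proj₂ p) ⁻¹))
     × (∀ (i j r s : Bool) x y → InS x y →
          (InSijrs i j r s x y ⇔ InSijrs j i s r y x)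
        × (InSijrs j i s r y x ⇔ InSijrs (not i) (not j) (not r) (not s) (x ⁻¹) (y ⁻¹)))
proposition2p3 F = swap-permutes-S , ⁻¹-permutes-S , λ i j r s x y (_ , _ , _ , x≉0 , _ , y≉0 , _) →
    mk⇔ InSijrs-swap InSijrs-swap ,
    mk⇔ (InSijrs-⁻¹ ∘ InSijrs-swap)
        (InSijrs-swap ∘ InSijrs-resp (⁻¹-involutive x≉0) (⁻¹-involutive y≉0)
                      ∘ InSijrs-unflip ∘ InSijrs-⁻¹)
  where
  open SymmetriesOfS F
  open FieldFacts F using (⁻¹-involutive)
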